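{- Let $n\ge 4$ and let $B$ be the $(n-1)\times(n-1)$ real matrix with entries $B_{ij}=0$ unless $|i-j|=1$, and for $1\le i\le n-2$: $B_{i,i+1}=2$ if $i=n-2$ and $B_{i,i+1}=1$ otherwise; $B_{i+1,i}=2$ if $i=1$ and $B_{i+1,i}=1$ otherwise. Let $W(B)=\begin{bmatrix} e_{n-1} & Be_{n-1} & \cdots & B^{n-2}e_{n-1}\end{bmatrix}$, where $e_{n-1}$ is the all-ones vector of length $n-1$. Then $\operatorname{rank}W(B)=\lfloor n/2\rfloor$.
   Context: $B$ is the tridiagonal matrix with zero diagonal, all super- and sub-diagonal entries equal to $1$ except that the $(2,1)$ entry and the $(n-2,n-1)$ entry equal $2$. It is the divisor matrix of the equitable partition $\{\{1,2\},\{3\},\ldots,\{n-1\},\{n,n+1\}\}$ of the extended Dynkin graph $\tilde{D}_n$. -}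

module Defs where

open import Data.Nat using (ℕ; zero; suc; _∸_; _≡ᵇ_; _+_)
open import Data.Fin using (Fin; toℕ) renaming (zero to fzero; suc to fsuc)
open import Data.Bool using (if_then_else_)
open import Data.Rational using (ℚ; 0ℚ; 1ℚ) renaming (_+_ to _+ℚ_; _*_ to _*ℚ_)
open import Data.Product using (∃; _×_)
open import Relation.Binary.PropositionalEquality using (_≡_)
open import Relation.Nullary using (¬_)

Matrix : ℕ → ℕ → Set
Matrix m k = Fin m → Fin k → ℚ

Vector : ℕ → Set
Vector m = Fin m → ℚ

∑ : (k : ℕ) → (Fin k → ℚ) → ℚ
∑ zero    f = 0ℚ
∑ (suc k) f = f fzero +ℚ ∑ k (λ i → f (fsuc i))

_⊗_ : ∀ {a b c} → Matrix a b → Matrix b c → Matrix a c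
_⊗_ {b = b} M N i j = ∑ b (λ l → M i l *ℚ N l j)

idMat : ∀ {a} → Matrix a a
idMat i j = if toℕ i ≡ᵇ toℕ j then 1ℚ else 0ℚ

_^M_ : ∀ {a} → Matrix a a → ℕ → Matrix a a
M ^M zero    = idMat
M ^M (suc k) = M ⊗ (M ^M k)

_·V_ : ∀ {a b} → Matrix a b → Vector b → Vector a
_·V_ {b = b} M v i = ∑ b (λ l → M i l *ℚ v l)

ones : ∀ {a} → Vector a
ones _ = 1ℚ

-- Superdiagonal (i, i+1): 2 if i = n-3 (i.e. 1-indexed row n-2), else 1.
-- Subdiagonal (j+1, j): 2 if j = 0 (i.e. 1-indexed entry (2,1)), else 1.
Bmat : (n : ℕ) → Matrix (n ∸ 1) (n ∸ 1)
Bmat n i j =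
  if suc (toℕ i) ≡ᵇ toℕ j then (if toℕ i ≡ᵇ (n ∸ 3) then 2ℚ' else 1ℚ)
  else if suc (toℕ j) ≡ᵇ toℕ i then (if toℕ j ≡ᵇ 0 then 2ℚ' else 1ℚ)
  else 0ℚ
  where 2ℚ' = 1ℚ +ℚ 1ℚ

Wmat : (n : ℕ) → Matrix (n ∸ 1) (n ∸ 1)
Wmat n i k = ((Bmat n ^M toℕ k) ·V ones) i

LinIndep : ∀ {m k} → (Fin k → Vector m) → Set
LinIndep {m} {k} v =
  (c : Fin k → ℚ) → (∀ i → ∑ k (λ j → c j *ℚ v j i) ≡ 0ℚ) → ∀ j → c j ≡ 0ℚ

col : ∀ {a b} → Matrix a b → Fin b → Vector a
col M j i = M i j

HasRank : ∀ {a b} → Matrix a b → ℕ → Set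
HasRank {a} {b} M r =
  (∃ λ (s : Fin r → Fin b) → LinIndep (λ t → col M (s t)))
  × ((s : Fin (suc r) → Fin b) → ¬ LinIndep (λ t → col M (s t)))

module Submission where

-- Write uₖ = Bᵏe, so the columns of W(B) are u₀, …, uₙ₋₂. Every column of B sums to 2, hence
-- Σₐ uₖ(a) = 2ᵏ(n − 1); B commutes with reversing the coordinates, hence every uₖ is a palindrome;
-- and away from its two ends B acts like a path with all weights 1, hence uₖ(a) = 2ᵏ at coordinates
-- more than k steps from both ends, whereas uₜ(t) = 2ᵗ + 1 (2ᵗ + 2 at the centre when n is even).
-- For r = ⌊n/2⌋ the functionals v ↦ Σ v / (n − 1) and v ↦ v(t) − Σ v / (n − 1), 0 < t < r, therefore
-- send u₀, …, uᵣ₋₁ to an upper triangular matrix with nonzero diagonal, so these columns are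
-- independent; and each uₖ is determined by its first r coordinates, so any r + 1 columns are dependent.

open import Defs
open import Algebra.Bundles using (CommutativeRing)
import Algebra.Properties.Group as GroupProperties
import Algebra.Properties.Semiring.Sum as SemiringSum
open import Data.Bool using (true; false; if_then_else_)
open import Data.Fin as Fin
  using (Fin; toℕ; fromℕ; fromℕ<; inject₁; inject≤; punchIn; punchOut)
  renaming (zero to fzero; suc to fsuc)
import Data.Fin.Properties as Finₚ
open import Data.Fin.Relation.Unary.Top using (View; view; ‵fromℕ; ‵inject₁)
open import Data.Nat as ℕ using (ℕ; zero; suc; _≡ᵇ_; _≤_; _<_; _/_; z≤n; s≤s; ⌊_/2⌋)
import Data.Nat.Properties as ℕₚ
open import Data.Nat.DivMod using (m/n≡1+[m∸n]/n)
open import Data.Product using (∃; _×_; _,_)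
open import Data.Rational using (ℚ; 0ℚ; 1ℚ; _+_; _*_; -_; 1/_; ≢-nonZero; NonNegative)
open import Data.Rational.Properties
open import Data.Rational.Solver using (module +-*-Solver)
open import Function using (_∘_)
open import Relation.Binary.PropositionalEquality
open import Relation.Nullary using (¬_; yes; no)
open import Relation.Nullary.Decidable using (dec-true; dec-false)

open +-*-Solver using (solve; _:+_; _:*_; :-_; _:=_; con)
open GroupProperties +-0-group using (x∙y⁻¹≈ε⇒x≈y; identityʳ-unique)

private
  module Σ = SemiringSum (CommutativeRing.semiring +-*-commutativeRing)

∑≡sum : ∀ k (f : Fin k → ℚ) → ∑ k f ≡ Σ.sum f
∑≡sum zero    f = refl
∑≡sum (suc k) f = cong (f fzero +_) (∑≡sum k (λ i → f (fsuc i)))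

∑-cong : ∀ k {f g : Fin k → ℚ} → (∀ i → f i ≡ g i) → ∑ k f ≡ ∑ k g
∑-cong k {f} {g} f≗g = trans (∑≡sum k f) (trans (Σ.sum-cong-≗ f≗g) (sym (∑≡sum k g)))

∑-zero : ∀ k {f : Fin k → ℚ} → (∀ i → f i ≡ 0ℚ) → ∑ k f ≡ 0ℚ
∑-zero k f≗0 = trans (∑-cong k f≗0) (trans (∑≡sum k _) (Σ.sum-replicate-zero k))

∑-distrib-+ : ∀ k (f g : Fin k → ℚ) → ∑ k (λ i → f i + g i) ≡ ∑ k f + ∑ k g
∑-distrib-+ k f g = trans (∑≡sum k _)
  (trans (Σ.∑-distrib-+ f g) (sym (cong₂ _+_ (∑≡sum k f) (∑≡sum k g))))

*-distribˡ-∑ : ∀ k x (f : Fin k → ℚ) → x * ∑ k f ≡ ∑ k (λ i → x * f i)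
*-distribˡ-∑ k x f = trans (cong (x *_) (∑≡sum k f))
  (trans (Σ.*-distribˡ-sum x f) (sym (∑≡sum k _)))

*-distribʳ-∑ : ∀ k x (f : Fin k → ℚ) → ∑ k f * x ≡ ∑ k (λ i → f i * x)
*-distribʳ-∑ k x f = trans (cong (_* x) (∑≡sum k f))
  (trans (Σ.*-distribʳ-sum x f) (sym (∑≡sum k _)))

∑-comm : ∀ a b (f : Fin a → Fin b → ℚ) →
         ∑ a (λ i → ∑ b (f i)) ≡ ∑ b (λ j → ∑ a (λ i → f i j))
∑-comm a b f = begin
  ∑ a (λ i → ∑ b (f i))               ≡⟨ ∑-cong a (λ i → ∑≡sum b (f i)) ⟩
  ∑ a (λ i → Σ.sum (f i))             ≡⟨ ∑≡sum a _ ⟩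
  Σ.sum (λ i → Σ.sum (f i))           ≡⟨ Σ.∑-comm f ⟩
  Σ.sum (λ j → Σ.sum (λ i → f i j))   ≡⟨ ∑≡sum b _ ⟨
  ∑ b (λ j → Σ.sum (λ i → f i j))     ≡⟨ ∑-cong b (λ j → ∑≡sum a (λ i → f i j)) ⟨
  ∑ b (λ j → ∑ a (λ i → f i j))       ∎
  where open ≡-Reasoning

∑-init-last : ∀ k (f : Fin (suc k) → ℚ) → ∑ (suc k) f ≡ ∑ k (f ∘ inject₁) + f (fromℕ k)
∑-init-last k f = trans (∑≡sum (suc k) f)
  (trans (Σ.sum-init-last f) (cong (_+ f (fromℕ k)) (sym (∑≡sum k _))))

∑-point : ∀ k (f : Fin k → ℚ) p → (∀ j → j ≢ p → f j ≡ 0ℚ) → ∑ k f ≡ f p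
∑-point (suc k) f fzero    f≡0 =
  trans (cong (f fzero +_) (∑-zero k (λ j → f≡0 (fsuc j) (λ ())))) (+-identityʳ _)
∑-point (suc k) f (fsuc p) f≡0 =
  trans (cong₂ _+_ (f≡0 fzero (λ ()))
                   (∑-point k (f ∘ fsuc) p (λ j j≢p → f≡0 (fsuc j) (j≢p ∘ Finₚ.suc-injective))))
        (+-identityˡ _)

x*y≡0⇒x≡0 : ∀ {x y} → y ≢ 0ℚ → x * y ≡ 0ℚ → x ≡ 0ℚ
x*y≡0⇒x≡0 {x} {y} y≢0 xy≡0 = begin
  x                  ≡⟨ *-identityʳ x ⟨
  x * 1ℚ             ≡⟨ cong (x *_) (*-inverseʳ y) ⟨
  x * (y * 1/ y)     ≡⟨ *-assoc x y (1/ y) ⟨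
  (x * y) * 1/ y     ≡⟨ cong (_* 1/ y) xy≡0 ⟩
  0ℚ * 1/ y          ≡⟨ *-zeroˡ (1/ y) ⟩
  0ℚ                 ∎
  where
  open ≡-Reasoning
  instance _ = ≢-nonZero y≢0

x+y≢x : ∀ x {y} → y ≢ 0ℚ → x + y ≢ x
x+y≢x x {y} y≢0 x+y≡x = y≢0 (identityʳ-unique x y x+y≡x)

LinIndep⇒head≢0 : ∀ {m k} {v : Fin (suc k) → Vector m} → LinIndep v → ¬ (∀ i → v fzero i ≡ 0ℚ)
LinIndep⇒head≢0 {k = k} {v} independent head≡0 = 1≢0 (independent e₀ combination fzero)
  where
  e₀ : Fin (suc k) → ℚ
  e₀ fzero    = 1ℚ
  e₀ (fsuc _) = 0ℚ
  combination : ∀ i → ∑ (suc k) (λ j → e₀ j * v j i) ≡ 0ℚ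
  combination i = trans (cong₂ _+_ (trans (*-identityˡ _) (head≡0 i))
                                   (∑-zero k (λ j → *-zeroˡ (v (fsuc j) i))))
                        (+-identityˡ 0ℚ)

-- One step of Gaussian elimination: column q is cleared below the pivot v 0 q and then deleted.
module Elimination {k m} (v : Fin (suc k) → Vector (suc m)) (q : Fin (suc m))
                   (pivot≢0 : v fzero q ≢ 0ℚ) where

  private instance _ = ≢-nonZero pivot≢0

  factor : Fin k → ℚ
  factor j = - (v (fsuc j) q * 1/ v fzero q)

  reduced : Fin k → Vector (suc m)
  reduced j i = v (fsuc j) i + factor j * v fzero i

  reduced-pivot : ∀ j → reduced j q ≡ 0ℚ
  reduced-pivot j = begin
    a + - (a * 1/ p) * p      ≡⟨ cong (a +_) (neg-distribˡ-* (a * 1/ p) p) ⟨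
    a + - (a * 1/ p * p)      ≡⟨ cong (λ x → a + - x) (*-assoc a (1/ p) p) ⟩
    a + - (a * (1/ p * p))    ≡⟨ cong (λ x → a + - (a * x)) (*-inverseˡ p) ⟩
    a + - (a * 1ℚ)            ≡⟨ cong (λ x → a + - x) (*-identityʳ a) ⟩
    a + - a                   ≡⟨ +-inverseʳ a ⟩
    0ℚ                        ∎
    where
    open ≡-Reasoning
    a = v (fsuc j) q
    p = v fzero q

  eliminated : Fin k → Vector m
  eliminated j i = reduced j (punchIn q i)

  LinIndep-eliminated : LinIndep v → LinIndep eliminated
  LinIndep-eliminated independent c dependency j = independent c⁺ combination (fsuc j)
    where
    c⁺ : Fin (suc k) → ℚ
    c⁺ fzero    = ∑ k (λ j → c j * factor j)
    c⁺ (fsuc j) = c j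
    lift : ∀ i → ∑ (suc k) (λ j → c⁺ j * v j i) ≡ ∑ k (λ j → c j * reduced j i)
    lift i = begin
      c⁺ fzero * v fzero i + ∑ k (λ j → c j * v (fsuc j) i)
        ≡⟨ +-comm (c⁺ fzero * v fzero i) (∑ k (λ j → c j * v (fsuc j) i)) ⟩
      ∑ k (λ j → c j * v (fsuc j) i) + c⁺ fzero * v fzero i
        ≡⟨ cong (∑ k (λ j → c j * v (fsuc j) i) +_)
                (*-distribʳ-∑ k (v fzero i) (λ j → c j * factor j)) ⟩
      ∑ k (λ j → c j * v (fsuc j) i) + ∑ k (λ j → c j * factor j * v fzero i)
        ≡⟨ ∑-distrib-+ k _ _ ⟨
      ∑ k (λ j → c j * v (fsuc j) i + c j * factor j * v fzero i)
        ≡⟨ ∑-cong k (λ j → trans (cong (c j * v (fsuc j) i +_) (*-assoc (c j) (factor j) (v fzero i)))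
                                   (sym (*-distribˡ-+ (c j) (v (fsuc j) i) (factor j * v fzero i)))) ⟩
      ∑ k (λ j → c j * reduced j i)
        ∎
      where open ≡-Reasoning
    reduced-combination : ∀ i → ∑ k (λ j → c j * reduced j i) ≡ 0ℚ
    reduced-combination i with q Fin.≟ i
    ... | yes refl = ∑-zero k (λ j → trans (cong (c j *_) (reduced-pivot j)) (*-zeroʳ (c j)))
    ... | no q≢i   = trans (∑-cong k (λ j → cong (λ i′ → c j * reduced j i′) (sym (Finₚ.punchIn-punchOut q≢i))))
                           (dependency (punchOut q≢i))
    combination : ∀ i → ∑ (suc k) (λ j → c⁺ j * v j i) ≡ 0ℚ
    combination i = trans (lift i) (reduced-combination i)

¬LinIndep-suc : ∀ m (v : Fin (suc m) → Vector m) → ¬ LinIndep v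
¬LinIndep-suc zero    v independent = LinIndep⇒head≢0 {v = v} independent (λ ())
¬LinIndep-suc (suc m) v independent with Finₚ.all? (λ i → v fzero i ≟ 0ℚ)
... | yes head≡0 = LinIndep⇒head≢0 {v = v} independent head≡0
... | no  head≢0 with Finₚ.¬∀⟶∃¬ (suc m) _ (λ i → v fzero i ≟ 0ℚ) head≢0
...   | q , pivot≢0 = ¬LinIndep-suc m eliminated (LinIndep-eliminated independent)
  where open Elimination v q pivot≢0

LinIndep-restrict : ∀ {k m r} (v : Fin k → Vector m) (ρ : Fin r → Fin m) →
                    (∀ i → ∃ λ i′ → ∀ j → v j i ≡ v j (ρ i′)) →
                    LinIndep v → LinIndep (λ j → v j ∘ ρ)
LinIndep-restrict {k} v ρ copy independent c dependency = independent c combination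
  where
  combination : ∀ i → ∑ k (λ j → c j * v j i) ≡ 0ℚ
  combination i with copy i
  ... | i′ , v≡ = trans (∑-cong k (λ j → cong (c j *_) (v≡ j))) (dependency i′)

upperTriangular⇒LinIndep : ∀ {r} (T : Matrix r r) →
                           (∀ t j → toℕ j < toℕ t → T t j ≡ 0ℚ) → (∀ t → T t t ≢ 0ℚ) →
                           LinIndep (col T)
upperTriangular⇒LinIndep {zero}  T T-upper T-diag c dependency ()
upperTriangular⇒LinIndep {suc r} T T-upper T-diag c dependency j = vanish (view j)
  where
  last : Fin (suc r)
  last = fromℕ r
  init : ∀ t → ℚ
  init t = ∑ r (λ j → c (inject₁ j) * T t (inject₁ j))
  split : ∀ t → ∑ (suc r) (λ j → c j * T t j) ≡ init t + c last * T t last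
  split t = ∑-init-last r (λ j → c j * T t j)
  init-last≡0 : init last ≡ 0ℚ
  init-last≡0 = ∑-zero r (λ j → trans (cong (c (inject₁ j) *_) (T-upper last (inject₁ j) (inject₁<last j)))
                                      (*-zeroʳ (c (inject₁ j))))
    where
    inject₁<last : ∀ j → toℕ (inject₁ j) < toℕ last
    inject₁<last j = subst₂ _<_ (sym (Finₚ.toℕ-inject₁ j)) (sym (Finₚ.toℕ-fromℕ r)) (Finₚ.toℕ<n j)
  c-last≡0 : c last ≡ 0ℚ
  c-last≡0 = x*y≡0⇒x≡0 (T-diag last) (begin
    c last * T last last           ≡⟨ +-identityˡ _ ⟨
    0ℚ + c last * T last last      ≡⟨ cong (_+ c last * T last last) init-last≡0 ⟨
    init last + c last * T last last ≡⟨ split last ⟨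
    ∑ (suc r) (λ j → c j * T last j) ≡⟨ dependency last ⟩
    0ℚ                             ∎)
    where open ≡-Reasoning
  T′ : Matrix r r
  T′ t j = T (inject₁ t) (inject₁ j)
  T′-upper : ∀ t j → toℕ j < toℕ t → T′ t j ≡ 0ℚ
  T′-upper t j j<t = T-upper _ _ (subst₂ _<_ (sym (Finₚ.toℕ-inject₁ j)) (sym (Finₚ.toℕ-inject₁ t)) j<t)
  dependency′ : ∀ t → init (inject₁ t) ≡ 0ℚ
  dependency′ t = begin
    init t′                          ≡⟨ +-identityʳ _ ⟨
    init t′ + 0ℚ                     ≡⟨ cong (init t′ +_) (trans (cong (_* T t′ last) c-last≡0)
                                                                 (*-zeroˡ (T t′ last))) ⟨
    init t′ + c last * T t′ last     ≡⟨ split t′ ⟨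
    ∑ (suc r) (λ j → c j * T t′ j)   ≡⟨ dependency t′ ⟩
    0ℚ                               ∎
    where
    open ≡-Reasoning
    t′ = inject₁ t
  vanish : ∀ {j} → View j → c j ≡ 0ℚ
  vanish ‵fromℕ        = c-last≡0
  vanish (‵inject₁ j′) =
    upperTriangular⇒LinIndep T′ T′-upper (λ t → T-diag (inject₁ t)) (c ∘ inject₁) dependency′ j′

≡ᵇ-true : ∀ {m n} → m ≡ n → (m ≡ᵇ n) ≡ true
≡ᵇ-true {m} {n} = dec-true (m ℕₚ.≟ n)

≡ᵇ-false : ∀ {m n} → m ≢ n → (m ≡ᵇ n) ≡ false
≡ᵇ-false {m} {n} = dec-false (m ℕₚ.≟ n)

idMat-·V : ∀ {a} (v : Vector a) i → (idMat ·V v) i ≡ v i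
idMat-·V {a} v i = trans (∑-point a (λ l → idMat i l * v l) i off-diagonal) on-diagonal
  where
  on-diagonal : idMat i i * v i ≡ v i
  on-diagonal rewrite ≡ᵇ-true (refl {x = toℕ i}) = *-identityˡ (v i)
  off-diagonal : ∀ l → l ≢ i → idMat i l * v l ≡ 0ℚ
  off-diagonal l l≢i rewrite ≡ᵇ-false (l≢i ∘ sym ∘ Finₚ.toℕ-injective) = *-zeroˡ (v l)

·V-⊗ : ∀ {a b c} (A : Matrix a b) (B : Matrix b c) (v : Vector c) i →
       ((A ⊗ B) ·V v) i ≡ (A ·V (B ·V v)) i
·V-⊗ {b = b} {c} A B v i = begin
  ∑ c (λ l → ∑ b (λ m → A i m * B m l) * v l)
    ≡⟨ ∑-cong c (λ l → *-distribʳ-∑ b (v l) (λ m → A i m * B m l)) ⟩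
  ∑ c (λ l → ∑ b (λ m → A i m * B m l * v l))
    ≡⟨ ∑-comm c b (λ l m → A i m * B m l * v l) ⟩
  ∑ b (λ m → ∑ c (λ l → A i m * B m l * v l))
    ≡⟨ ∑-cong b (λ m → ∑-cong c (λ l → *-assoc (A i m) (B m l) (v l))) ⟩
  ∑ b (λ m → ∑ c (λ l → A i m * (B m l * v l)))
    ≡⟨ ∑-cong b (λ m → *-distribˡ-∑ c (A i m) (λ l → B m l * v l)) ⟨
  ∑ b (λ m → A i m * ∑ c (λ l → B m l * v l))
    ∎
  where open ≡-Reasoning

∑ℕ : ℕ → (ℕ → ℚ) → ℚ
∑ℕ k f = ∑ k (λ i → f (toℕ i))

∑ℕ-point : ∀ k (f : ℕ → ℚ) {p} → p < k → (∀ j → j < k → j ≢ p → f j ≡ 0ℚ) → ∑ℕ k f ≡ f p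
∑ℕ-point k f {p} p<k f≡0 =
  trans (∑-point k (f ∘ toℕ) (fromℕ< p<k) off) (cong f (Finₚ.toℕ-fromℕ< p<k))
  where
  off : ∀ j → j ≢ fromℕ< p<k → f (toℕ j) ≡ 0ℚ
  off j j≢p = f≡0 (toℕ j) (Finₚ.toℕ<n j)
    (λ j≡p → j≢p (Finₚ.toℕ-injective (trans j≡p (sym (Finₚ.toℕ-fromℕ< p<k)))))

∑ℕ-pair : ∀ k (f : ℕ → ℚ) {p q} → p < q → q < k → (∀ j → j < k → j ≢ p → j ≢ q → f j ≡ 0ℚ) →
          ∑ℕ k f ≡ f p + f q
∑ℕ-pair (suc k) f {zero}  {suc q} _         (s≤s q<k) f≡0 =
  cong (f 0 +_) (∑ℕ-point k (f ∘ suc) q<k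
                  (λ j j<k j≢q → f≡0 (suc j) (s≤s j<k) (λ ()) (j≢q ∘ ℕₚ.suc-injective)))
∑ℕ-pair (suc k) f {suc p} {suc q} (s≤s p<q) (s≤s q<k) f≡0 =
  trans (cong₂ _+_ (f≡0 0 (s≤s z≤n) (λ ()) (λ ()))
                   (∑ℕ-pair k (f ∘ suc) p<q q<k
                     (λ j j<k j≢p j≢q → f≡0 (suc j) (s≤s j<k) (j≢p ∘ ℕₚ.suc-injective)
                                                                 (j≢q ∘ ℕₚ.suc-injective))))
        (+-identityˡ _)

2ℚ : ℚ
2ℚ = 1ℚ + 1ℚ

infix 8 2^_
2^_ : ℕ → ℚ
2^ zero  = 1ℚ
2^ suc k = 2^ k + 2^ k

∑ℕ-ones-nonNeg : ∀ k → NonNegative (∑ℕ k (λ _ → 1ℚ))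
∑ℕ-ones-nonNeg zero    = _
∑ℕ-ones-nonNeg (suc k) = nonNeg+nonNeg⇒nonNeg 1ℚ (∑ℕ k (λ _ → 1ℚ)) {{∑ℕ-ones-nonNeg k}}

∑ℕ-ones≢0 : ∀ k → ∑ℕ (suc k) (λ _ → 1ℚ) ≢ 0ℚ
∑ℕ-ones≢0 k ∑≡0 = <⇒≢ (positive⁻¹ _ {{positive}}) (sym ∑≡0)
  where positive = pos+nonNeg⇒pos 1ℚ (∑ℕ k (λ _ → 1ℚ)) {{∑ℕ-ones-nonNeg k}}

-- n = M + 4 and coordinates are 0-based, running over 0 … M + 2; u k a = (Bᵏe)ₐ, junk for a ≥ N.
module Tridiagonal (M : ℕ) where

  N : ℕ
  N = 3 ℕ.+ M

  B : ℕ → ℕ → ℚ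
  B x y =
    if suc x ≡ᵇ y then (if x ≡ᵇ suc M then 2ℚ else 1ℚ)
    else if suc y ≡ᵇ x then (if y ≡ᵇ 0 then 2ℚ else 1ℚ)
    else 0ℚ

  Bmat≡B : ∀ i j → Bmat (4 ℕ.+ M) i j ≡ B (toℕ i) (toℕ j)
  Bmat≡B i j = refl

  B-far : ∀ {x y} → suc x ≢ y → suc y ≢ x → B x y ≡ 0ℚ
  B-far x+1≢y y+1≢x rewrite ≡ᵇ-false x+1≢y | ≡ᵇ-false y+1≢x = refl

  B-super : ∀ x → B x (suc x) ≡ (if x ≡ᵇ suc M then 2ℚ else 1ℚ)
  B-super x rewrite ≡ᵇ-true (refl {x = x}) = refl

  B-super-1 : ∀ {x} → x ≢ suc M → B x (suc x) ≡ 1ℚ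
  B-super-1 {x} x≢1+M = trans (B-super x) (cong (λ b → if b then 2ℚ else 1ℚ) (≡ᵇ-false x≢1+M))

  B-super-top : B (suc M) (2 ℕ.+ M) ≡ 2ℚ
  B-super-top = trans (B-super (suc M)) (cong (λ b → if b then 2ℚ else 1ℚ) (≡ᵇ-true (refl {x = M})))

  B-sub-1 : ∀ y → B (2 ℕ.+ y) (suc y) ≡ 1ℚ
  B-sub-1 y rewrite ≡ᵇ-false (ℕₚ.<⇒≢ (ℕₚ.m<n⇒m<1+n (ℕₚ.n<1+n (suc y))) ∘ sym)
                  | ≡ᵇ-true (refl {x = y}) = refl

  B-mirror : ∀ b b′ → b ℕ.+ b′ ≡ M → B (suc b) b ≡ B (suc b′) (2 ℕ.+ b′)
  B-mirror zero    _  refl = sym B-super-top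
  B-mirror (suc b) b′ b+b′≡M = trans (B-sub-1 b) (sym (B-super-1 b′≢M))
    where
    b′≢M : suc b′ ≢ suc M
    b′≢M b′+1≡M+1 =
      ℕₚ.m≢1+n+m M (trans (sym b+b′≡M) (cong (λ x → suc (b ℕ.+ x)) (ℕₚ.suc-injective b′+1≡M+1)))

  u : ℕ → ℕ → ℚ
  u zero    a = 1ℚ
  u (suc k) a = ∑ℕ N (λ j → B a j * u k j)

  u-first : ∀ k → u (suc k) 0 ≡ u k 1
  u-first k = trans (∑ℕ-point N (λ j → B 0 j * u k j) (s≤s (s≤s z≤n)) off) (*-identityˡ (u k 1))
    where
    off : ∀ j → j < N → j ≢ 1 → B 0 j * u k j ≡ 0ℚ
    off j _ j≢1 = trans (cong (_* u k j) (B-far (j≢1 ∘ sym) (λ ()))) (*-zeroˡ (u k j))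

  u-last : ∀ k → u (suc k) (2 ℕ.+ M) ≡ u k (suc M)
  u-last k = trans (∑ℕ-point N (λ j → B (2 ℕ.+ M) j * u k j) (ℕₚ.n≤1+n (2 ℕ.+ M)) off)
                   (trans (cong (_* u k (suc M)) (B-sub-1 M)) (*-identityˡ (u k (suc M))))
    where
    off : ∀ j → j < N → j ≢ suc M → B (2 ℕ.+ M) j * u k j ≡ 0ℚ
    off j j<N j≢1+M =
      trans (cong (_* u k j) (B-far (λ e → ℕₚ.<-irrefl (sym e) j<N) (j≢1+M ∘ ℕₚ.suc-injective)))
            (*-zeroˡ (u k j))

  u-inner : ∀ k {b} → b ≤ M → u (suc k) (suc b) ≡ B (suc b) b * u k b + B (suc b) (2 ℕ.+ b) * u k (2 ℕ.+ b)
  u-inner k {b} b≤M =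
    ∑ℕ-pair N (λ j → B (suc b) j * u k j) (ℕₚ.m<n⇒m<1+n (ℕₚ.n<1+n b)) (s≤s (s≤s (s≤s b≤M))) off
    where
    off : ∀ j → j < N → j ≢ b → j ≢ 2 ℕ.+ b → B (suc b) j * u k j ≡ 0ℚ
    off j _ j≢b j≢2+b =
      trans (cong (_* u k j) (B-far (j≢2+b ∘ sym) (j≢b ∘ ℕₚ.suc-injective))) (*-zeroˡ (u k j))

  u-mirror : ∀ k a a′ → a ℕ.+ a′ ≡ 2 ℕ.+ M → u k a ≡ u k a′
  u-mirror zero    _ _ _ = refl
  u-mirror (suc k) zero    _        refl =
    trans (u-first k) (trans (u-mirror k 1 (suc M) refl) (sym (u-last k)))
  u-mirror (suc k) (suc b) zero     a+0≡2+M with trans (sym (ℕₚ.+-identityʳ (suc b))) a+0≡2+M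
  ... | refl = trans (u-last k) (trans (u-mirror k (suc M) 1 (ℕₚ.+-comm (suc M) 1)) (sym (u-first k)))
  u-mirror (suc k) (suc b) (suc b′) a+a′≡2+M = begin
    u (suc k) (suc b)
      ≡⟨ u-inner k (subst (b ≤_) b+b′≡M (ℕₚ.m≤m+n b b′)) ⟩
    B (suc b) b * u k b + B (suc b) (2 ℕ.+ b) * u k (2 ℕ.+ b)
      ≡⟨ cong₂ _+_ (cong₂ _*_ (B-mirror b b′ b+b′≡M) (u-mirror k b (2 ℕ.+ b′) b+[2+b′]≡2+M))
                   (cong₂ _*_ (sym (B-mirror b′ b b′+b≡M))
                              (u-mirror k (2 ℕ.+ b) b′ (cong (suc ∘ suc) b+b′≡M))) ⟩
    B (suc b′) (2 ℕ.+ b′) * u k (2 ℕ.+ b′) + B (suc b′) b′ * u k b′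
      ≡⟨ +-comm (B (suc b′) (2 ℕ.+ b′) * u k (2 ℕ.+ b′)) (B (suc b′) b′ * u k b′) ⟩
    B (suc b′) b′ * u k b′ + B (suc b′) (2 ℕ.+ b′) * u k (2 ℕ.+ b′)
      ≡⟨ u-inner k (subst (b′ ≤_) b+b′≡M (ℕₚ.m≤n+m b′ b)) ⟨
    u (suc k) (suc b′) ∎
    where
    open ≡-Reasoning
    b+[1+b′]≡1+M : b ℕ.+ suc b′ ≡ suc M
    b+[1+b′]≡1+M = ℕₚ.suc-injective a+a′≡2+M
    b+b′≡M : b ℕ.+ b′ ≡ M
    b+b′≡M = ℕₚ.suc-injective (trans (sym (ℕₚ.+-suc b b′)) b+[1+b′]≡1+M)
    b′+b≡M : b′ ℕ.+ b ≡ M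
    b′+b≡M = trans (ℕₚ.+-comm b′ b) b+b′≡M
    b+[2+b′]≡2+M : b ℕ.+ (2 ℕ.+ b′) ≡ 2 ℕ.+ M
    b+[2+b′]≡2+M = trans (ℕₚ.+-suc b (suc b′)) (cong suc b+[1+b′]≡1+M)

  u-interior : ∀ k {a} → k < a → a ℕ.+ k ≤ suc M → u k a ≡ 2^ k
  u-interior zero    _ _ = refl
  u-interior (suc k) {suc (suc c)} (s≤s (s≤s k≤c)) a+k+1≤M+1 = begin
    u (suc k) (2 ℕ.+ c)
      ≡⟨ u-inner k (ℕₚ.≤-trans (ℕₚ.n≤1+n _) 2+c≤M) ⟩
    B (2 ℕ.+ c) (suc c) * u k (suc c) + B (2 ℕ.+ c) (3 ℕ.+ c) * u k (3 ℕ.+ c)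
      ≡⟨ cong₂ _+_ (cong₂ _*_ (B-sub-1 c) (u-interior k (s≤s k≤c) left))
                   (cong₂ _*_ (B-super-1 (ℕₚ.<⇒≢ (s≤s 2+c≤M))) (u-interior k k<3+c (s≤s 2+c+k≤M))) ⟩
    1ℚ * 2^ k + 1ℚ * 2^ k
      ≡⟨ cong₂ _+_ (*-identityˡ (2^ k)) (*-identityˡ (2^ k)) ⟩
    2^ suc k ∎
    where
    open ≡-Reasoning
    2+c+k≤M : 2 ℕ.+ (c ℕ.+ k) ≤ M
    2+c+k≤M = subst (λ x → suc x ≤ M) (ℕₚ.+-suc c k) (ℕₚ.≤-pred a+k+1≤M+1)
    2+c≤M : 2 ℕ.+ c ≤ M
    2+c≤M = ℕₚ.≤-trans (s≤s (s≤s (ℕₚ.m≤m+n c k))) 2+c+k≤M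
    left : suc c ℕ.+ k ≤ suc M
    left = ℕₚ.m≤n⇒m≤1+n (ℕₚ.≤-trans (ℕₚ.n≤1+n _) 2+c+k≤M)
    k<3+c : k < 3 ℕ.+ c
    k<3+c = s≤s (ℕₚ.m≤n⇒m≤1+n (ℕₚ.m≤n⇒m≤1+n k≤c))

  u-diagonal : ∀ k → suc (k ℕ.+ k) ≤ M → u (suc k) (suc k) ≡ 2^ suc k + 1ℚ
  u-diagonal zero 1≤M =
    trans (u-inner 0 z≤n) (cong (λ x → 2ℚ * 1ℚ + x * 1ℚ) (B-super-1 (ℕₚ.<⇒≢ (s≤s 1≤M))))
  u-diagonal (suc k) 2k+3≤M = begin
    u (2 ℕ.+ k) (2 ℕ.+ k)
      ≡⟨ u-inner (suc k) (ℕₚ.≤-trans (s≤s (ℕₚ.m≤m+n k k)) 2k+1≤M) ⟩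
    B (2 ℕ.+ k) (suc k) * u (suc k) (suc k) + B (2 ℕ.+ k) (3 ℕ.+ k) * u (suc k) (3 ℕ.+ k)
      ≡⟨ cong₂ _+_ (cong₂ _*_ (B-sub-1 k) (u-diagonal k 2k+1≤M))
                   (cong₂ _*_ (B-super-1 (ℕₚ.<⇒≢ (s≤s 2+k≤M)))
                              (u-interior (suc k) (ℕₚ.n≤1+n (2 ℕ.+ k)) (s≤s 2k+3≤M))) ⟩
    1ℚ * (2^ suc k + 1ℚ) + 1ℚ * 2^ suc k
      ≡⟨ solve 1 (λ x → con 1ℚ :* (x :+ con 1ℚ) :+ con 1ℚ :* x := (x :+ x) :+ con 1ℚ) refl (2^ suc k) ⟩
    2^ suc (suc k) + 1ℚ ∎
    where
    open ≡-Reasoning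
    3+2k≤M : 3 ℕ.+ (k ℕ.+ k) ≤ M
    3+2k≤M = subst (λ x → suc (suc x) ≤ M) (ℕₚ.+-suc k k) 2k+3≤M
    2k+1≤M : suc (k ℕ.+ k) ≤ M
    2k+1≤M = ℕₚ.≤-trans (ℕₚ.n≤1+n _) (ℕₚ.≤-trans (ℕₚ.n≤1+n _) 3+2k≤M)
    2+k≤M : 2 ℕ.+ k ≤ M
    2+k≤M = ℕₚ.≤-trans (s≤s (s≤s (ℕₚ.m≤m+n k k))) (ℕₚ.≤-trans (ℕₚ.n≤1+n _) 3+2k≤M)

  u-centre : ∀ k → M ≡ k ℕ.+ k → u (suc k) (suc k) ≡ 2^ suc k + 2ℚ
  u-centre zero M≡0 =
    trans (u-inner 0 z≤n) (cong (λ x → 2ℚ * 1ℚ + x * 1ℚ) B₁₂≡2)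
    where
    B₁₂≡2 : B 1 2 ≡ 2ℚ
    B₁₂≡2 = subst (λ m → B (suc m) (2 ℕ.+ m) ≡ 2ℚ) M≡0 B-super-top
  u-centre (suc k) M≡2k+2 = begin
    u (2 ℕ.+ k) (2 ℕ.+ k)
      ≡⟨ u-inner (suc k) (ℕₚ.≤-trans (s≤s (ℕₚ.m≤m+n k k)) 2k+1≤M) ⟩
    B (2 ℕ.+ k) (suc k) * u (suc k) (suc k) + B (2 ℕ.+ k) (3 ℕ.+ k) * u (suc k) (3 ℕ.+ k)
      ≡⟨ cong₂ _+_ (cong₂ _*_ (B-sub-1 k) (u-diagonal k 2k+1≤M))
                   (cong₂ _*_ (B-super-1 (ℕₚ.<⇒≢ (s≤s 2+k≤M))) (trans mirrored (u-diagonal k 2k+1≤M))) ⟩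
    1ℚ * (2^ suc k + 1ℚ) + 1ℚ * (2^ suc k + 1ℚ)
      ≡⟨ solve 1 (λ x → con 1ℚ :* (x :+ con 1ℚ) :+ con 1ℚ :* (x :+ con 1ℚ) := (x :+ x) :+ (con 1ℚ :+ con 1ℚ))
                 refl (2^ suc k) ⟩
    2^ suc (suc k) + 2ℚ ∎
    where
    open ≡-Reasoning
    M≡2+2k : M ≡ 2 ℕ.+ (k ℕ.+ k)
    M≡2+2k = trans M≡2k+2 (cong suc (ℕₚ.+-suc k k))
    2k+1≤M : suc (k ℕ.+ k) ≤ M
    2k+1≤M = ℕₚ.≤-trans (ℕₚ.n≤1+n _) (ℕₚ.≤-reflexive (sym M≡2+2k))
    2+k≤M : 2 ℕ.+ k ≤ M
    2+k≤M = ℕₚ.≤-trans (s≤s (s≤s (ℕₚ.m≤m+n k k))) (ℕₚ.≤-reflexive (sym M≡2+2k))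
    mirrored : u (suc k) (3 ℕ.+ k) ≡ u (suc k) (suc k)
    mirrored = u-mirror (suc k) (3 ℕ.+ k) (suc k) (cong (suc ∘ suc) (sym M≡2k+2))

  u-diagonal≢ : ∀ k → k ℕ.+ k ≤ M → u (suc k) (suc k) ≢ 2^ suc k
  u-diagonal≢ k 2k≤M with suc (k ℕ.+ k) ℕ.≤? M
  ... | yes 2k+1≤M = λ e → x+y≢x (2^ suc k) 1≢0 (trans (sym (u-diagonal k 2k+1≤M)) e)
  ... | no  2k+1≰M = λ e → x+y≢x (2^ suc k) (λ ()) (trans (sym (u-centre k M≡2k)) e)
    where
    M≡2k : M ≡ k ℕ.+ k
    M≡2k = ℕₚ.≤-antisym (ℕₚ.≤-pred (ℕₚ.≰⇒> 2k+1≰M)) 2k≤M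

  B-column-sum : ∀ j → j < N → ∑ℕ N (λ a → B a j) ≡ 2ℚ
  B-column-sum zero    _ =
    ∑ℕ-point N (λ a → B a 0) (s≤s (s≤s z≤n)) (λ a _ a≢1 → B-far (λ ()) (a≢1 ∘ sym))
  B-column-sum (suc b) b+1<N with b ℕₚ.≟ suc M
  ... | yes refl = trans (∑ℕ-point N (λ a → B a (2 ℕ.+ M)) (ℕₚ.n≤1+n (2 ℕ.+ M)) off) B-super-top
    where
    off : ∀ a → a < N → a ≢ suc M → B a (2 ℕ.+ M) ≡ 0ℚ
    off a a<N a≢1+M = B-far (a≢1+M ∘ ℕₚ.suc-injective) (λ e → ℕₚ.<-irrefl (sym e) a<N)
  ... | no b≢1+M = trans (∑ℕ-pair N (λ a → B a (suc b)) (ℕₚ.m<n⇒m<1+n (ℕₚ.n<1+n b)) 2+b<N off)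
                         (cong₂ _+_ (B-super-1 b≢1+M) (B-sub-1 b))
    where
    2+b<N : 2 ℕ.+ b < N
    2+b<N = s≤s (s≤s (ℕₚ.≤∧≢⇒< (ℕₚ.≤-pred (ℕₚ.≤-pred b+1<N)) b≢1+M))
    off : ∀ a → a < N → a ≢ b → a ≢ 2 ℕ.+ b → B a (suc b) ≡ 0ℚ
    off a _ a≢b a≢2+b = B-far (a≢b ∘ ℕₚ.suc-injective) (a≢2+b ∘ sym)

  ∑ℕ-u : ∀ k → ∑ℕ N (u k) ≡ 2^ k * ∑ℕ N (u 0)
  ∑ℕ-u zero    = sym (*-identityˡ _)
  ∑ℕ-u (suc k) = begin
    ∑ℕ N (λ a → ∑ℕ N (λ j → B a j * u k j))
      ≡⟨ ∑-comm N N (λ a j → B (toℕ a) (toℕ j) * u k (toℕ j)) ⟩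
    ∑ℕ N (λ j → ∑ℕ N (λ a → B a j * u k j))
      ≡⟨ ∑-cong N (λ j → *-distribʳ-∑ N (u k (toℕ j)) (λ a → B (toℕ a) (toℕ j))) ⟨
    ∑ℕ N (λ j → ∑ℕ N (λ a → B a j) * u k j)
      ≡⟨ ∑-cong N (λ j → cong (_* u k (toℕ j)) (B-column-sum (toℕ j) (Finₚ.toℕ<n j))) ⟩
    ∑ℕ N (λ j → 2ℚ * u k j)
      ≡⟨ *-distribˡ-∑ N 2ℚ (λ j → u k (toℕ j)) ⟨
    2ℚ * ∑ℕ N (u k)
      ≡⟨ cong (2ℚ *_) (∑ℕ-u k) ⟩
    2ℚ * (2^ k * ∑ℕ N (u 0))
      ≡⟨ solve 2 (λ x σ → (con 1ℚ :+ con 1ℚ) :* (x :* σ) := (x :+ x) :* σ) refl (2^ k) (∑ℕ N (u 0)) ⟩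
    2^ suc k * ∑ℕ N (u 0) ∎
    where open ≡-Reasoning

  Wmat≡u : ∀ i k → Wmat (4 ℕ.+ M) i k ≡ u (toℕ k) (toℕ i)
  Wmat≡u i k = Bᵏ·ones≡u (toℕ k) i
    where
    Bᵏ·ones≡u : ∀ k i → ((Bmat (4 ℕ.+ M) ^M k) ·V ones) i ≡ u k (toℕ i)
    Bᵏ·ones≡u zero    i = idMat-·V ones i
    Bᵏ·ones≡u (suc k) i = trans (·V-⊗ (Bmat (4 ℕ.+ M)) (Bmat (4 ℕ.+ M) ^M k) ones i)
                                (∑-cong N (λ l → cong₂ _*_ (Bmat≡B i l) (Bᵏ·ones≡u k l)))

module Rank (M h : ℕ) (2h≤M : h ℕ.+ h ≤ M) (M≤2h+1 : M ≤ suc (h ℕ.+ h)) where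
  open Tridiagonal M

  r : ℕ
  r = 2 ℕ.+ h

  r≤N : r ≤ N
  r≤N = s≤s (s≤s (ℕₚ.m≤n⇒m≤1+n (ℕₚ.m+n≤o⇒m≤o h 2h≤M)))

  first : Fin r → Fin N
  first j = inject≤ j r≤N

  toℕ-first : ∀ j → toℕ (first j) ≡ toℕ j
  toℕ-first j = Finₚ.toℕ-inject≤ j r≤N

  column : Fin N → Vector N
  column = col (Wmat (4 ℕ.+ M))

  -- Row 0 is Σₐ uⱼ(a) / N, and row t > 0 vanishes for j < t because t is then an interior
  -- coordinate of uⱼ.
  triangle : Matrix r r
  triangle fzero    j = 2^ toℕ j
  triangle (fsuc t) j = u (toℕ j) (suc (toℕ t)) + - 2^ toℕ j

  triangle-upper : ∀ t j → toℕ j < toℕ t → triangle t j ≡ 0ℚ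
  triangle-upper (fsuc t) j j<t+1 =
    trans (cong (_+ - 2^ toℕ j) (u-interior (toℕ j) j<t+1 t+1+j≤M+1)) (+-inverseʳ (2^ toℕ j))
    where
    t≤h : toℕ t ≤ h
    t≤h = ℕₚ.≤-pred (Finₚ.toℕ<n t)
    j≤h : toℕ j ≤ h
    j≤h = ℕₚ.≤-trans (ℕₚ.≤-pred j<t+1) t≤h
    t+1+j≤M+1 : suc (toℕ t) ℕ.+ toℕ j ≤ suc M
    t+1+j≤M+1 = s≤s (ℕₚ.≤-trans (ℕₚ.+-mono-≤ t≤h j≤h) 2h≤M)

  triangle-diagonal≢0 : ∀ t → triangle t t ≢ 0ℚ
  triangle-diagonal≢0 fzero    = 1≢0
  triangle-diagonal≢0 (fsuc t) =
    u-diagonal≢ (toℕ t) (ℕₚ.≤-trans (ℕₚ.+-mono-≤ t≤h t≤h) 2h≤M) ∘ x∙y⁻¹≈ε⇒x≈y _ _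
    where
    t≤h : toℕ t ≤ h
    t≤h = ℕₚ.≤-pred (Finₚ.toℕ<n t)

  combination : (Fin r → ℚ) → ℕ → ℚ
  combination c a = ∑ r (λ j → c j * u (toℕ j) a)

  module _ (c : Fin r → ℚ) (combination≡0 : ∀ (i : Fin N) → combination c (toℕ i) ≡ 0ℚ) where

    ∑c2ʲ≡0 : ∑ r (λ j → c j * 2^ toℕ j) ≡ 0ℚ
    ∑c2ʲ≡0 = x*y≡0⇒x≡0 (∑ℕ-ones≢0 (2 ℕ.+ M)) (begin
      ∑ r (λ j → c j * 2^ toℕ j) * σ
        ≡⟨ *-distribʳ-∑ r σ (λ j → c j * 2^ toℕ j) ⟩
      ∑ r (λ j → c j * 2^ toℕ j * σ)
        ≡⟨ ∑-cong r (λ j → trans (*-assoc (c j) (2^ toℕ j) σ) (cong (c j *_) (sym (∑ℕ-u (toℕ j))))) ⟩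
      ∑ r (λ j → c j * ∑ℕ N (u (toℕ j)))
        ≡⟨ ∑-cong r (λ j → *-distribˡ-∑ N (c j) (λ i → u (toℕ j) (toℕ i))) ⟩
      ∑ r (λ j → ∑ N (λ i → c j * u (toℕ j) (toℕ i)))
        ≡⟨ ∑-comm r N (λ j i → c j * u (toℕ j) (toℕ i)) ⟩
      ∑ N (λ i → combination c (toℕ i))
        ≡⟨ ∑-zero N combination≡0 ⟩
      0ℚ ∎)
      where
      open ≡-Reasoning
      σ = ∑ℕ N (λ _ → 1ℚ)

    triangle-rows : ∀ t → ∑ r (λ j → c j * triangle t j) ≡ 0ℚ
    triangle-rows fzero    = ∑c2ʲ≡0
    triangle-rows (fsuc t) = begin
      ∑cT
        ≡⟨ +-identityʳ ∑cT ⟨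
      ∑cT + 0ℚ
        ≡⟨ cong (∑cT +_) ∑c2ʲ≡0 ⟨
      ∑cT + ∑ r (λ j → c j * 2^ toℕ j)
        ≡⟨ ∑-distrib-+ r cT (λ j → c j * 2^ toℕ j) ⟨
      ∑ r (λ j → c j * triangle (fsuc t) j + c j * 2^ toℕ j)
        ≡⟨ ∑-cong r (λ j → cancel (c j) (u (toℕ j) (suc (toℕ t))) (2^ toℕ j)) ⟩
      combination c (suc (toℕ t))
        ≡⟨ subst (λ a → combination c a ≡ 0ℚ) (toℕ-first (fsuc t)) (combination≡0 (first (fsuc t))) ⟩
      0ℚ ∎
      where
      open ≡-Reasoning
      cT : Fin r → ℚ
      cT j = c j * triangle (fsuc t) j
      ∑cT = ∑ r cT
      cancel : ∀ γ x y → γ * (x + - y) + γ * y ≡ γ * x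
      cancel = solve 3 (λ γ x y → γ :* (x :+ :- y) :+ γ :* y := γ :* x) refl

  independent : LinIndep (column ∘ first)
  independent c dependency =
    upperTriangular⇒LinIndep triangle triangle-upper triangle-diagonal≢0 c (triangle-rows c combination≡0)
    where
    entry : ∀ i j → column (first j) i ≡ u (toℕ j) (toℕ i)
    entry i j = trans (Wmat≡u i (first j)) (cong (λ k → u k (toℕ i)) (toℕ-first j))
    combination≡0 : ∀ i → combination c (toℕ i) ≡ 0ℚ
    combination≡0 i = trans (∑-cong r (λ j → cong (c j *_) (sym (entry i j)))) (dependency i)

  mirror-coordinate : ∀ (i : Fin N) → ∃ λ (i′ : Fin r) → ∀ k → u k (toℕ i) ≡ u k (toℕ (first i′))
  mirror-coordinate i with toℕ i ℕ.<? r
  ... | yes i<r = fromℕ< i<r , λ k → cong (u k) (sym (trans (toℕ-first _) (Finₚ.toℕ-fromℕ< i<r)))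
  ... | no  i≮r = fromℕ< a′<r , λ k → trans (u-mirror k (toℕ i) a′ i+a′≡2+M)
                                          (cong (u k) (sym (trans (toℕ-first _) (Finₚ.toℕ-fromℕ< a′<r))))
    where
    a′ : ℕ
    a′ = (2 ℕ.+ M) ℕ.∸ toℕ i
    i+a′≡2+M : toℕ i ℕ.+ a′ ≡ 2 ℕ.+ M
    i+a′≡2+M = ℕₚ.m+[n∸m]≡n (ℕₚ.≤-pred (Finₚ.toℕ<n i))
    a′<r : a′ < r
    a′<r = s≤s (ℕₚ.≤-trans (ℕₚ.∸-monoʳ-≤ (2 ℕ.+ M) (ℕₚ.≮⇒≥ i≮r))
                           (ℕₚ.m≤n+o⇒m∸n≤o M h (subst (M ≤_) (sym (ℕₚ.+-suc h h)) M≤2h+1)))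

  dependent : (s : Fin (suc r) → Fin N) → ¬ LinIndep (column ∘ s)
  dependent s independent′ = ¬LinIndep-suc r (λ t → column (s t) ∘ first)
                                           (LinIndep-restrict (column ∘ s) first copy independent′)
    where
    copy : ∀ i → ∃ λ i′ → ∀ t → column (s t) i ≡ column (s t) (first i′)
    copy i with mirror-coordinate i
    ... | i′ , u≡ = i′ , λ t → trans (Wmat≡u i (s t))
                                     (trans (u≡ (toℕ (s t))) (sym (Wmat≡u (first i′) (s t))))

  hasRank : HasRank (Wmat (4 ℕ.+ M)) r
  hasRank = (first , independent) , dependent

⌊n/2⌋-bounds : ∀ n → ⌊ n /2⌋ ℕ.+ ⌊ n /2⌋ ≤ n × n ≤ suc (⌊ n /2⌋ ℕ.+ ⌊ n /2⌋)
⌊n/2⌋-bounds zero          = z≤n , z≤n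
⌊n/2⌋-bounds (suc zero)    = z≤n , s≤s z≤n
⌊n/2⌋-bounds (suc (suc n)) with ⌊n/2⌋-bounds n
... | lower , upper = subst (_≤ 2 ℕ.+ n) (sym h+1+h+1≡) (s≤s (s≤s lower))
                    , subst (λ x → 2 ℕ.+ n ≤ suc x) (sym h+1+h+1≡) (s≤s (s≤s upper))
  where
  h+1+h+1≡ : suc ⌊ n /2⌋ ℕ.+ suc ⌊ n /2⌋ ≡ 2 ℕ.+ (⌊ n /2⌋ ℕ.+ ⌊ n /2⌋)
  h+1+h+1≡ = cong suc (ℕₚ.+-suc ⌊ n /2⌋ ⌊ n /2⌋)

n/2≡⌊n/2⌋ : ∀ n → n / 2 ≡ ⌊ n /2⌋
n/2≡⌊n/2⌋ zero          = refl
n/2≡⌊n/2⌋ (suc zero)    = refl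
n/2≡⌊n/2⌋ (suc (suc n)) =
  trans (m/n≡1+[m∸n]/n {2 ℕ.+ n} {2} (s≤s (s≤s z≤n))) (cong suc (n/2≡⌊n/2⌋ n))

theorem2p5 : (n : ℕ) → 4 ≤ n → HasRank (Wmat n) (n / 2)
theorem2p5 (suc (suc (suc (suc M)))) (s≤s (s≤s (s≤s (s≤s z≤n)))) with ⌊n/2⌋-bounds M
... | 2h≤M , M≤2h+1 =
  subst (HasRank (Wmat (4 ℕ.+ M))) (sym (n/2≡⌊n/2⌋ (4 ℕ.+ M))) (Rank.hasRank M ⌊ M /2⌋ 2h≤M M≤2h+1)
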